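{- Let $\mathbf c=(c_1,\dots,c_m)$ and $\mathbf d=(d_1,\dots,d_n)$ be IP sequences. Let $x,y\in\mathbb N$ with $y\ge2$. Let $l=\max\{m,n\}$, $h=\max\{c_m,d_n\}$, and $V\subseteq[l]\times[2,h]$. Let $\mathcal A\subseteq\mathcal L_{\mathbf c}^{(\le m)}$ and $\mathcal B\subseteq\mathcal L_{\mathbf d}^{(\le n)}$ be such that $(A\cap B)\setminus V\ne\emptyset$ for every $A\in\mathcal A$ and $B\in\mathcal B$. Then $(C\cap D)\setminus(V\cup\{(x,y)\})\ne\emptyset$ for every $C\in\Gamma_{x,y}(\mathcal A)$ and every $D\in\Gamma_{x,y}(\mathcal B)$.
   Context: An IP sequence is $(c_1,\dots,c_n)$ with $1\le c_1\le\dots\le c_n$ integers. $[a,b]=\{i\in\mathbb N\colon a\le i\le b\}$, $[k]=[1,k]$. For an IP sequence $\mathbf c=(c_1,\dots,c_n)$ and integer $r$, $\mathcal L_{\mathbf c}^{(r)}=\{\{(i_1,a_{i_1}),\dots,(i_r,a_{i_r})\}\colon\{i_1,\dots,i_r\}\text{ an }r\text{ -subset of }[n],\ a_{i_j}\in[c_{i_j}]\text{ for each }j\}$, and $\mathcal L_{\mathbf c}^{(\le r)}=\bigcup_{i=1}^r\mathcal L_{\mathbf c}^{(i)}$. For $x,y\in\mathbb N$ and a set $A$ of pairs (a labeled set), $\gamma_{x,y}(A)=(A\setminus\{(x,y)\})\cup\{(x,1)\}$ if $(x,y)\in A$, and $\gamma_{x,y}(A)=A$ otherwise; for a family $\mathcal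 A$ of such sets, $\Gamma_{x,y}(\mathcal A)=\{\gamma_{x,y}(A)\colon A\in\mathcal A,\ \gamma_{x,y}(A)\notin\mathcal A\}\cup\{A\in\mathcal A\colon\gamma_{x,y}(A)\in\mathcal A\}$. -}

module Defs where

open import Data.Nat using (ℕ; zero; suc; _≤_; _⊔_; _≡ᵇ_)
open import Data.Bool using (Bool; true; false; if_then_else_; _∧_)
open import Data.Fin using (Fin; toℕ; fromℕ; suc; zero)
open import Data.Maybe using (Maybe; just; nothing)
open import Data.Vec using (Vec; lookup; tabulate; last)
open import Data.Product using (Σ; _×_; ∃-syntax)
open import Relation.Binary.PropositionalEquality using (_≡_; _≢_)

-- IP sequence (c₁,…,cₘ): 1 ≤ c₁ ≤ … ≤ cₘ.  Position k : Fin m stands for index toℕ k + 1.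
IPSeq : ∀ {m} → Vec ℕ m → Set
IPSeq {m} c = (∀ (k : Fin m) → 1 ≤ lookup c k)
            × (∀ (j k : Fin m) → toℕ j ≤ toℕ k → lookup c j ≤ lookup c k)

-- A labeled set whose first coordinates lie in [m] is a partial function [m] ⇀ ℕ:
-- entry k = just a  means  (toℕ k + 1 , a) ∈ A;  nothing means index toℕ k + 1 is absent.
LSet : ℕ → Set
LSet m = Vec (Maybe ℕ) m

_∈L_ : ∀ {m} → ℕ × ℕ → LSet m → Set
_∈L_ {m} (i Data.Product., a) A = Σ (Fin m) λ k → (suc (toℕ k) ≡ i) × (lookup A k ≡ just a)

InLle : ∀ {m} → Vec ℕ m → LSet m → Set
InLle {m} c A = (∀ (k : Fin m) (a : ℕ) → lookup A k ≡ just a → (1 ≤ a) × (a ≤ lookup c k))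
              × (Σ (Fin m) λ k → lookup A k ≢ nothing)

Family : ℕ → Set
Family m = LSet m → Bool

γ-entry : ℕ → ℕ → ℕ → Maybe ℕ → Maybe ℕ
γ-entry x y i nothing = nothing
γ-entry x y i (just a) = if (i ≡ᵇ x) ∧ (a ≡ᵇ y) then just 1 else just a

γ : ∀ {m} → ℕ → ℕ → LSet m → LSet m
γ x y A = tabulate λ k → γ-entry x y (suc (toℕ k)) (lookup A k)

InΓ : ∀ {m} → ℕ → ℕ → Family m → LSet m → Set
InΓ {m} x y 𝒜 C =
  (Σ (LSet m) λ A → (𝒜 A ≡ true) × (γ x y A ≡ C) × (𝒜 (γ x y A) ≡ false))
  Data.Sum.⊎ ((𝒜 C ≡ true) × (𝒜 (γ x y C) ≡ true))
  where import Data.Sum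

-- γ = γ_{x,y} changes at most the entry at x, and leaves a set without the label (x,y) unchanged.
-- Hence a set that Γ moves contains (x,y), and γ of any set never contains (x,y) (as y ≠ 1).
-- A common element (i,a) ∉ V of two original sets therefore survives into C ∩ D whenever i ≠ x.
-- At i = x: if both sets were moved they both now contain (x,1) ∉ V; if exactly one was moved,
-- its partner γ D or D cannot meet it at x; if neither was moved and they meet only at (x,y),
-- intersect γ C ∈ 𝒜 with D instead, which cannot meet at x either.
module Submission where

open import Defs
open import Data.Nat using (ℕ; suc; _≤_; _⊔_; _≡ᵇ_)
open import Data.Nat.Properties using (≡ᵇ⇒≡; ≡⇒≡ᵇ; _≟_; suc-injective; >⇒≢; <-irrefl)
open import Data.Bool using (Bool; true; false)
open import Data.Bool.Properties using (T-≡)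
open import Data.Maybe using (just; nothing)
open import Data.Maybe.Properties using (just-injective)
open import Data.Fin using (Fin; toℕ)
open import Data.Fin.Properties using (toℕ-injective)
open import Data.Vec using (Vec; last; lookup; tabulate)
open import Data.Vec.Properties using (lookup∘tabulate; tabulate∘lookup; tabulate-cong)
open import Data.Product using (Σ; _×_; _,_; proj₁; proj₂)
open import Data.Sum using (inj₁; inj₂)
open import Data.Empty using (⊥; ⊥-elim)
open import Function.Bundles using (Equivalence)
open import Relation.Nullary using (¬_; yes; no)
open import Relation.Binary.PropositionalEquality
  using (_≡_; _≢_; refl; sym; trans; cong)

≡ᵇ-true⇒≡ : ∀ {m n} → (m ≡ᵇ n) ≡ true → m ≡ n
≡ᵇ-true⇒≡ {m} {n} e = ≡ᵇ⇒≡ m n (Equivalence.from T-≡ e)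

≡⇒≡ᵇ-true : ∀ {m n} → m ≡ n → (m ≡ᵇ n) ≡ true
≡⇒≡ᵇ-true {m} {n} e = Equivalence.to T-≡ (≡⇒≡ᵇ m n e)

∈L-functional : ∀ {m} (A : LSet m) {i a b} → (i , a) ∈L A → (i , b) ∈L A → a ≡ b
∈L-functional A (k , i≡k , A[k]≡a) (k′ , i≡k′ , A[k′]≡b)
  with toℕ-injective (suc-injective (trans i≡k (sym i≡k′)))
... | refl = just-injective (trans (sym A[k]≡a) A[k′]≡b)

MeetWhere : ∀ {m n} → (ℕ → ℕ → Set) → LSet m → LSet n → Set
MeetWhere P A B = Σ ℕ λ i → Σ ℕ λ a → ((i , a) ∈L A) × ((i , a) ∈L B) × P i a

record _⊆_off_ {m} (A C : LSet m) (x : ℕ) : Set where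
  constructor ⊆-off
  field ⊆-away : ∀ {i a} → i ≢ x → (i , a) ∈L A → (i , a) ∈L C
open _⊆_off_

⊆-refl-off : ∀ {m} (A : LSet m) {x} → A ⊆ A off x
⊆-refl-off _ = ⊆-off λ _ ia∈A → ia∈A

module _ (x y : ℕ) (y≢1 : y ≢ 1) where

  γ-entry-off : ∀ {i} v → i ≢ x → γ-entry x y i v ≡ v
  γ-entry-off nothing i≢x = refl
  γ-entry-off {i} (just a) i≢x with i ≡ᵇ x in i≡ᵇx
  ... | true = ⊥-elim (i≢x (≡ᵇ-true⇒≡ i≡ᵇx))
  ... | false = refl

  γ-entry-keeps : ∀ {i a} → a ≢ y → γ-entry x y i (just a) ≡ just a
  γ-entry-keeps {i} {a} a≢y with i ≡ᵇ x | a ≡ᵇ y in a≡ᵇy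
  ... | true | true = ⊥-elim (a≢y (≡ᵇ-true⇒≡ a≡ᵇy))
  ... | true | false = refl
  ... | false | _ = refl

  γ-entry-xy : γ-entry x y x (just y) ≡ just 1
  γ-entry-xy rewrite ≡⇒≡ᵇ-true {x} refl | ≡⇒≡ᵇ-true {y} refl = refl

  γ-entry-at-x-≢y : ∀ v {a} → γ-entry x y x v ≡ just a → a ≢ y
  γ-entry-at-x-≢y nothing ()
  γ-entry-at-x-≢y (just b) e a≡y rewrite ≡⇒≡ᵇ-true {x} refl with b ≡ᵇ y in b≡ᵇy
  ... | true = y≢1 (trans (sym a≡y) (sym (just-injective e)))
  ... | false with () ← trans (sym (≡⇒≡ᵇ-true (trans (just-injective e) a≡y))) b≡ᵇy

  module _ {m : ℕ} where

    lookup-γ : (A : LSet m) (k : Fin m) →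
               lookup (γ x y A) k ≡ γ-entry x y (suc (toℕ k)) (lookup A k)
    lookup-γ A k = lookup∘tabulate _ k

    ⊆-γ-off : (A : LSet m) → A ⊆ γ x y A off x
    ⊆-γ-off A = ⊆-off λ where
      i≢x (k , refl , A[k]≡a) →
        k , refl , trans (lookup-γ A k) (trans (γ-entry-off _ i≢x) A[k]≡a)

    γ-⊆-off : (A : LSet m) → γ x y A ⊆ A off x
    γ-⊆-off A = ⊆-off λ where
      i≢x (k , refl , γA[k]≡a) →
        k , refl , trans (sym (γ-entry-off _ i≢x)) (trans (sym (lookup-γ A k)) γA[k]≡a)

    xy∉γ : (A : LSet m) → ¬ ((x , y) ∈L γ x y A)
    xy∉γ A (k , refl , γA[k]≡y) = γ-entry-at-x-≢y (lookup A k) (trans (sym (lookup-γ A k)) γA[k]≡y) refl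

    x1∈γ : (A : LSet m) → (x , y) ∈L A → (x , 1) ∈L γ x y A
    x1∈γ A (k , refl , A[k]≡y) =
      k , refl , trans (lookup-γ A k) (trans (cong (γ-entry x y x) A[k]≡y) γ-entry-xy)

    γ-fixes : (A : LSet m) {a : ℕ} → (x , a) ∈L A → a ≢ y → γ x y A ≡ A
    γ-fixes A {a} xa∈A a≢y = trans (tabulate-cong γ-entry-fixed) (tabulate∘lookup A)
      where
        γ-entry-fixed : ∀ k → γ-entry x y (suc (toℕ k)) (lookup A k) ≡ lookup A k
        γ-entry-fixed k with lookup A k in A[k]≡v
        ... | nothing = refl
        ... | just b with suc (toℕ k) ≟ x
        ...   | no k≢x = γ-entry-off _ k≢x
        ...   | yes k≡x = γ-entry-keeps {suc (toℕ k)} λ b≡y →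
                  a≢y (trans (∈L-functional A xa∈A (k , k≡x , A[k]≡v)) b≡y)

    moved⇒label≡y : (𝒜 : Family m) {A : LSet m} → 𝒜 A ≡ true → 𝒜 (γ x y A) ≡ false →
                    ∀ {a} → (x , a) ∈L A → a ≡ y
    moved⇒label≡y 𝒜 {A} A∈𝒜 γA∉𝒜 {a} xa∈A with a ≟ y
    ... | yes a≡y = a≡y
    ... | no a≢y with () ← trans (sym A∈𝒜) (trans (cong 𝒜 (sym (γ-fixes A xa∈A a≢y))) γA∉𝒜)

  module _ (V : ℕ → ℕ → Bool) where

    OutsideV : ℕ → ℕ → Set
    OutsideV i a = V i a ≡ false

    OutsideVxy : ℕ → ℕ → Set
    OutsideVxy i a = V i a ≡ false × ¬ (i ≡ x × a ≡ y)

    meet-lift : ∀ {m n} {A C : LSet m} {B D : LSet n} → A ⊆ C off x → B ⊆ D off x →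
                (∀ {a} → (x , a) ∈L A → (x , a) ∈L B → V x a ≡ false → MeetWhere OutsideVxy C D) →
                MeetWhere OutsideV A B → MeetWhere OutsideVxy C D
    meet-lift A⊆C B⊆D at-x (i , a , ia∈A , ia∈B , ia∉V) with i ≟ x
    ... | no i≢x = i , a , ⊆-away A⊆C i≢x ia∈A , ⊆-away B⊆D i≢x ia∈B , ia∉V , λ (i≡x , _) → i≢x i≡x
    ... | yes refl = at-x ia∈A ia∈B ia∉V

    module _ (x1∉V : V x 1 ≡ false) {m n} (𝒜 : Family m) (ℬ : Family n)
             (cross : ∀ A B → 𝒜 A ≡ true → ℬ B ≡ true → MeetWhere OutsideV A B) where

      Γ-cross-intersecting : ∀ C D → InΓ x y 𝒜 C → InΓ x y ℬ D → MeetWhere OutsideVxy C D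
      Γ-cross-intersecting _ _ (inj₁ (A , A∈𝒜 , refl , γA∉𝒜)) (inj₁ (B , B∈ℬ , refl , γB∉ℬ)) =
        meet-lift (⊆-γ-off A) (⊆-γ-off B) both-moved (cross A B A∈𝒜 B∈ℬ)
        where
          both-moved : ∀ {a} → (x , a) ∈L A → (x , a) ∈L B → V x a ≡ false →
                       MeetWhere OutsideVxy (γ x y A) (γ x y B)
          both-moved xa∈A xa∈B _ with refl ← moved⇒label≡y 𝒜 A∈𝒜 γA∉𝒜 xa∈A =
            x , 1 , x1∈γ A xa∈A , x1∈γ B xa∈B , x1∉V , λ (_ , 1≡y) → y≢1 (sym 1≡y)
      Γ-cross-intersecting _ D (inj₁ (A , A∈𝒜 , refl , γA∉𝒜)) (inj₂ (_ , γD∈ℬ)) =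
        meet-lift (⊆-γ-off A) (γ-⊆-off D) at-x (cross A (γ x y D) A∈𝒜 γD∈ℬ)
        where
          at-x : ∀ {a} → (x , a) ∈L A → (x , a) ∈L γ x y D → V x a ≡ false →
                 MeetWhere OutsideVxy (γ x y A) D
          at-x xa∈A xa∈γD _ with refl ← moved⇒label≡y 𝒜 A∈𝒜 γA∉𝒜 xa∈A = ⊥-elim (xy∉γ D xa∈γD)
      Γ-cross-intersecting C _ (inj₂ (_ , γC∈𝒜)) (inj₁ (B , B∈ℬ , refl , γB∉ℬ)) =
        meet-lift (γ-⊆-off C) (⊆-γ-off B) at-x (cross (γ x y C) B γC∈𝒜 B∈ℬ)
        where
          at-x : ∀ {a} → (x , a) ∈L γ x y C → (x , a) ∈L B → V x a ≡ false →
                 MeetWhere OutsideVxy C (γ x y B)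
          at-x xa∈γC xa∈B _ with refl ← moved⇒label≡y ℬ B∈ℬ γB∉ℬ xa∈B = ⊥-elim (xy∉γ C xa∈γC)
      Γ-cross-intersecting C D (inj₂ (C∈𝒜 , γC∈𝒜)) (inj₂ (D∈ℬ , _)) =
        meet-lift (⊆-refl-off C) (⊆-refl-off D) at-x (cross C D C∈𝒜 D∈ℬ)
        where
          at-x : ∀ {a} → (x , a) ∈L C → (x , a) ∈L D → V x a ≡ false → MeetWhere OutsideVxy C D
          at-x {a} xa∈C xa∈D xa∉V with a ≟ y
          ... | no a≢y = x , a , xa∈C , xa∈D , xa∉V , λ (_ , a≡y) → a≢y a≡y
          ... | yes refl = meet-lift (γ-⊆-off C) (⊆-refl-off D) γC-at-x (cross (γ x y C) D γC∈𝒜 D∈ℬ)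
            where
              γC-at-x : ∀ {b} → (x , b) ∈L γ x y C → (x , b) ∈L D → V x b ≡ false →
                        MeetWhere OutsideVxy C D
              γC-at-x xb∈γC xb∈D _ with refl ← ∈L-functional D xa∈D xb∈D = ⊥-elim (xy∉γ C xb∈γC)

-- Only y ≠ 1 and (x,1) ∉ V are used.
lemma4p1 : (m′ n′ : ℕ) (c : Vec ℕ (suc m′)) (d : Vec ℕ (suc n′)) →
    IPSeq c → IPSeq d →
    (x y : ℕ) → 2 ≤ y →
    (V : ℕ → ℕ → Bool) →
    (∀ i a → V i a ≡ true → (1 ≤ i) × (i ≤ (suc m′ ⊔ suc n′)) × (2 ≤ a) × (a ≤ (last c ⊔ last d))) →
    (𝒜 : Family (suc m′)) (ℬ : Family (suc n′)) →
    (∀ A → 𝒜 A ≡ true → InLle c A) →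
    (∀ B → ℬ B ≡ true → InLle d B) →
    (∀ A B → 𝒜 A ≡ true → ℬ B ≡ true →
      Σ ℕ λ i → Σ ℕ λ a → ((i , a) ∈L A) × ((i , a) ∈L B) × (V i a ≡ false)) →
    ∀ C D → InΓ x y 𝒜 C → InΓ x y ℬ D →
      Σ ℕ λ i → Σ ℕ λ a → ((i , a) ∈L C) × ((i , a) ∈L D) × (V i a ≡ false)
        × ((i ≡ x × a ≡ y) → ⊥)
lemma4p1 _ _ _ _ _ _ x y 2≤y V V⊆ 𝒜 ℬ _ _ cross =
  Γ-cross-intersecting x y y≢1 V x1∉V 𝒜 ℬ cross
  where
    y≢1 : y ≢ 1
    y≢1 = >⇒≢ 2≤y

    x1∉V : V x 1 ≡ false
    x1∉V with V x 1 in Vx1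
    ... | true = ⊥-elim (<-irrefl refl (proj₁ (proj₂ (proj₂ (V⊆ x 1 Vx1)))))
    ... | false = refl
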